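{- Let $b\ge2$ and $N\ge1$ be integers with $\gcd(N,b)=1$. If $2\in\mathcal{M}_b(N)$ and $d$ is an even divisor of $|b|_N$, then $d\in\mathcal{M}_b(N)$ and $m_b(d,N)=\frac d2$.
   Context: $|b|_N$ denotes the multiplicative order of $b$ modulo $N$, and $\mathbb{U}_N=\{x: 1\le x<N,\ \gcd(x,N)=1\}$. Midy's set: for an integer $d\ge 2$ dividing $|b|_N$, put $L=|b|_N$ and $k=L/d$. For $x\in\mathbb{U}_N$, let $a_1\cdots a_L$ be the base-$b$ digits (padded with leading zeros to exactly $L$ digits) of the integer $x(b^L-1)/N$ (the period of the base-$b$ expansion of $x/N$). For $j=1,\dots,d$ let $A_j=[a_{(j-1)k+1}\cdots a_{jk}]_b$ be the integer with the $j$-th block of $k$ digits, and $S_d(x)=\sum_{j=1}^d A_j$. $N$ has the Midy property for $b$ and $d$ if $b^k-1\mid S_d(x)$ for all $x\in\mathbb{U}_N$; $\mathcal{M}_b(N)$ is the set of such $d$. For $d\in\mathcal{M}_b(N)$ with $k=|b|_N/d$, the number $\sum_{i=1}^d (b^{ik}\bmod N)$ (where $y\bmod N$ is the least nonnegative residue) is a multiple of $N$, and $m_b(d,N)$ is defined by $\sum_{i=1}^d (b^{ik}\bmod N)=m_b(d,N)\,N$. -}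

module Defs where

open import Data.Nat using (ℕ; zero; suc; _+_; _*_; _∸_; _^_; _≤_; _<_; NonZero)
open import Data.Nat.Properties using (m^n≢0)
open import Data.Nat.DivMod using (_/_; _%_)
open import Data.Nat.Divisibility using (_∣_)
open import Data.Nat.Coprimality using (Coprime)
open import Data.Product using (_×_)
open import Relation.Binary.PropositionalEquality using (_≡_)
open import Relation.Nullary using (¬_)

sum1 : ℕ → (ℕ → ℕ) → ℕ
sum1 zero    f = 0
sum1 (suc n) f = sum1 n f + f (suc n)

-- L is the multiplicative order |b|_N : least L ≥ 1 with b^L ≡ 1 (mod N)
IsOrder : ℕ → ℕ → ℕ → Set
IsOrder b N L = (1 ≤ L) × (N ∣ (b ^ L ∸ 1)) × (∀ M → 1 ≤ M → M < L → ¬ (N ∣ (b ^ M ∸ 1)))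

InU : ℕ → ℕ → Set
InU N x = (1 ≤ x) × (x < N) × Coprime x N

period : (b N L x : ℕ) → .{{_ : NonZero N}} → ℕ
period b N L x = (x * (b ^ L ∸ 1)) / N

-- i-th base-b digit (i = 1..L, from the left) of y padded to L digits
digit : (b L y i : ℕ) → .{{_ : NonZero b}} → ℕ
digit b L y i = (y / b ^ (L ∸ i)) % b
  where instance _ = m^n≢0 b (L ∸ i)

-- A_j : integer formed by the j-th block of k digits a_{(j-1)k+1} ... a_{jk}
block : (b L k y j : ℕ) → .{{_ : NonZero b}} → ℕ
block b L k y j = sum1 k (λ t → digit b L y ((j ∸ 1) * k + t) * b ^ (k ∸ t))

S : (b N L d k x : ℕ) → .{{_ : NonZero b}} → .{{_ : NonZero N}} → ℕ
S b N L d k x = sum1 d (λ j → block b L k (period b N L x) j)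

-- Midy property for b and d, where L = |b|_N and k = L/d
-- (k is characterised by L ≡ d * k)
MidyProp : (b N L d : ℕ) → .{{_ : NonZero b}} → .{{_ : NonZero N}} → Set
MidyProp b N L d = ∀ k → L ≡ d * k → ∀ x → InU N x → (b ^ k ∸ 1) ∣ S b N L d k x

InMidySet : (b N L d : ℕ) → .{{_ : NonZero b}} → .{{_ : NonZero N}} → Set
InMidySet b N L d = (2 ≤ d) × (d ∣ L) × MidyProp b N L d

midySum : (b N d k : ℕ) → .{{_ : NonZero N}} → ℕ
midySum b N d k = sum1 d (λ i → (b ^ (i * k)) % N)

module Submission where

-- Write b^L − 1 = z·N, so the period of x/N is the integer x·z.  Cutting a
-- number y < b^{dk} into d blocks of k base-b digits, y ≡ Σ blocks modulo
-- b^k − 1 (because b^k ≡ 1); hence N has the Midy property for b and d iff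
-- b^k − 1 divides x·z for every x ∈ 𝕌_N.  With L = 2k₀ the case d = 2, x = 1
-- gives (b^{k₀} − 1) ∣ z.  For d = 2e and k = L/d we have k₀ = e·k, so
-- (b^k − 1) ∣ (b^{k₀} − 1) ∣ z ∣ x·z, which is the Midy property for d.
-- Moreover z·N = (b^{k₀} − 1)(b^{k₀} + 1) together with (b^{k₀} − 1) ∣ z gives
-- N ∣ b^{k₀} + 1, so b^{(e+i)k} ≡ −b^{ik} (mod N); the residues of the terms
-- i and e + i of the Midy sum therefore add up to exactly N (neither is 0 as
-- N is coprime to b and N ≠ 1), and the 2e terms sum to e·N.

open import Defs
open import Data.Nat
open import Data.Nat.Properties
open import Data.Nat.DivMod
open import Data.Nat.Divisibility
open import Data.Nat.Coprimality using (Coprime; coprime-divisor; 1-coprimeTo)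
open import Data.Product using (_×_; _,_; ∃; proj₁; proj₂)
open import Data.Empty using (⊥-elim)
open import Relation.Binary.PropositionalEquality
open import Relation.Nullary using (¬_)
open import Data.Nat.Tactic.RingSolver using (solve-∀)

sum1-cong : ∀ n {f g : ℕ → ℕ} → (∀ j → 1 ≤ j → j ≤ n → f j ≡ g j) → sum1 n f ≡ sum1 n g
sum1-cong zero    f≡g = refl
sum1-cong (suc n) f≡g =
  cong₂ _+_ (sum1-cong n (λ j 1≤j j≤n → f≡g j 1≤j (m≤n⇒m≤1+n j≤n))) (f≡g (suc n) (s≤s z≤n) ≤-refl)

sum1-* : ∀ n c f → sum1 n (λ j → c * f j) ≡ c * sum1 n f
sum1-* zero    c f = sym (*-zeroʳ c)
sum1-* (suc n) c f =
  trans (cong (_+ c * f (suc n)) (sum1-* n c f)) (sym (*-distribˡ-+ c (sum1 n f) (f (suc n))))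

sum1-+ : ∀ n f g → sum1 n (λ j → f j + g j) ≡ sum1 n f + sum1 n g
sum1-+ zero    f g = refl
sum1-+ (suc n) f g rewrite sum1-+ n f g = interchange (sum1 n f) (sum1 n g) (f (suc n)) (g (suc n))
  where
  interchange : ∀ a b c d → a + b + (c + d) ≡ a + c + (b + d)
  interchange = solve-∀

sum1-split : ∀ a c f → sum1 (a + c) f ≡ sum1 a f + sum1 c (λ i → f (a + i))
sum1-split a zero    f rewrite +-identityʳ a = sym (+-identityʳ _)
sum1-split a (suc c) f rewrite +-suc a c | sum1-split a c f = +-assoc (sum1 a f) _ _

sum1-const : ∀ n c → sum1 n (λ _ → c) ≡ n * c
sum1-const zero    c = refl
sum1-const (suc n) c rewrite sum1-const n c = +-comm (n * c) c

sum1-pairs : ∀ e f c → (∀ i → 1 ≤ i → i ≤ e → f i + f (e + i) ≡ c) → sum1 (e + e) f ≡ e * c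
sum1-pairs e f c pair = begin
  sum1 (e + e) f                       ≡⟨ sum1-split e e f ⟩
  sum1 e f + sum1 e (λ i → f (e + i))  ≡⟨ sym (sum1-+ e f (λ i → f (e + i))) ⟩
  sum1 e (λ i → f i + f (e + i))       ≡⟨ sum1-cong e pair ⟩
  sum1 e (λ _ → c)                     ≡⟨ sum1-const e c ⟩
  e * c                                ∎
  where open ≡-Reasoning

mixed-radix< : ∀ {a c r s} → r < c → s < a → a * r + s < a * c
mixed-radix< {a} {c} {r} {s} r<c s<a = begin-strict
  a * r + s    <⟨ +-monoʳ-< (a * r) s<a ⟩
  a * r + a    ≡⟨ trans (+-comm (a * r) a) (sym (*-suc a r)) ⟩
  a * suc r    ≤⟨ *-monoʳ-≤ a r<c ⟩
  a * c        ∎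
  where open ≤-Reasoning

%-*-split : ∀ z a c .{{_ : NonZero a}} .{{_ : NonZero c}} .{{_ : NonZero (a * c)}} →
            z % (a * c) ≡ a * ((z / a) % c) + z % a
%-*-split z a c = begin
  z % (a * c)                       ≡⟨ cong (_% (a * c)) z≡ ⟩
  (low + high * (a * c)) % (a * c)  ≡⟨ [m+kn]%n≡m%n low high (a * c) ⟩
  low % (a * c)                     ≡⟨ m<n⇒m%n≡m (mixed-radix< (m%n<n (z / a) c) (m%n<n z a)) ⟩
  low                               ∎
  where
  open ≡-Reasoning
  low : ℕ
  low = a * ((z / a) % c) + z % a
  high : ℕ
  high = (z / a) / c
  regroup : ∀ r r′ q a c → r + (r′ + q * c) * a ≡ a * r′ + r + q * (a * c)
  regroup = solve-∀
  z≡ : z ≡ low + high * (a * c)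
  z≡ = trans (m≡m%n+[m/n]*n z a)
             (trans (cong (λ u → z % a + u * a) (m≡m%n+[m/n]*n (z / a) c))
                    (regroup (z % a) ((z / a) % c) high a c))

-- Positional notation in base b.  Digit s of z (from the right, starting at 0)
-- is (z / b^s) mod b.
module Positional (b : ℕ) .{{_ : NonZero b}} where

  infixl 7 _/^_ _%^_

  _/^_ : ℕ → ℕ → ℕ
  z /^ s = _/_ z (b ^ s) {{m^n≢0 b s}}

  _%^_ : ℕ → ℕ → ℕ
  z %^ s = _%_ z (b ^ s) {{m^n≢0 b s}}

  -- Digit s + 1 of z is digit s of z / b.
  digit-shift : ∀ z s → ((z /^ suc s) % b) * b ^ suc s ≡ b * ((((z / b) /^ s) % b) * b ^ s)
  digit-shift z s =
    trans (cong (λ u → (u % b) * (b * b ^ s))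
                (sym (m/n/o≡m/[n*o] z b (b ^ s) {{_}} {{m^n≢0 b s}} {{m^n≢0 b (suc s)}})))
          (swap (((z / b) /^ s) % b) b (b ^ s))
    where
    swap : ∀ x y w → x * (y * w) ≡ y * (x * w)
    swap = solve-∀

  low-digits : ∀ k z → sum1 k (λ t → ((z /^ (k ∸ t)) % b) * b ^ (k ∸ t)) ≡ z %^ k
  low-digits zero    z = sym (n%1≡0 z)
  low-digits (suc k) z = begin
    sum1 k (λ t → place z (suc k ∸ t)) + place z (k ∸ k)
      ≡⟨ cong₂ _+_ (sum1-cong k (λ t _ t≤k → trans (cong (place z) (+-∸-assoc 1 t≤k)) (digit-shift z (k ∸ t))))
                   (trans (cong (place z) (n∸n≡0 k)) (trans (*-identityʳ _) (cong (_% b) (n/1≡n z)))) ⟩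
    sum1 k (λ t → b * place (z / b) (k ∸ t)) + z % b
      ≡⟨ cong (_+ z % b) (trans (sum1-* k b _) (cong (b *_) (low-digits k (z / b)))) ⟩
    b * ((z / b) %^ k) + z % b
      ≡⟨ sym (%-*-split z b (b ^ k) {{_}} {{m^n≢0 b k}} {{m^n≢0 b (suc k)}}) ⟩
    z %^ suc k ∎
    where
    open ≡-Reasoning
    place : ℕ → ℕ → ℕ
    place z s = ((z /^ s) % b) * b ^ s

  /^-+ : ∀ y m n → y /^ (m + n) ≡ (y /^ m) /^ n
  /^-+ y m n = trans (/-congʳ {{m^n≢0 b (m + n)}} {{nz}} (^-distribˡ-+-* b m n))
                      (sym (m/n/o≡m/[n*o] y (b ^ m) (b ^ n) {{m^n≢0 b m}} {{m^n≢0 b n}} {{nz}}))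
    where
    nz : NonZero (b ^ m * b ^ n)
    nz = subst NonZero (^-distribˡ-+-* b m n) (m^n≢0 b (m + n))

  -- In a number of d·k digits, digit t of block j (both counted from the left,
  -- from 1) sits at position (d − j)·k + (k − t) from the right.
  block-position : ∀ d k j t → 1 ≤ j → j ≤ d → t ≤ k →
                   d * k ∸ ((j ∸ 1) * k + t) ≡ (d ∸ j) * k + (k ∸ t)
  block-position d k (suc j) t _ j<d t≤k = trans (cong (_∸ (j * k + t)) d*k≡) (m+n∸m≡n (j * k + t) _)
    where
    expand : ∀ j r k → (suc j + r) * k ≡ j * k + k + r * k
    expand = solve-∀
    regroup : ∀ a t s c → a + (t + s) + c ≡ (a + t) + (c + s)
    regroup = solve-∀
    d*k≡ : d * k ≡ (j * k + t) + ((d ∸ suc j) * k + (k ∸ t))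
    d*k≡ = trans (cong (_* k) (sym (m+[n∸m]≡n j<d)))
             (trans (expand j (d ∸ suc j) k)
               (trans (cong (λ u → j * k + u + (d ∸ suc j) * k) (sym (m+[n∸m]≡n t≤k)))
                      (regroup (j * k) t (k ∸ t) ((d ∸ suc j) * k))))

  block≡ : ∀ d k j y → 1 ≤ j → j ≤ d → block b (d * k) k y j ≡ (y /^ ((d ∸ j) * k)) %^ k
  block≡ d k j y 1≤j j≤d =
    trans (sum1-cong k (λ t _ t≤k → cong (λ u → (u % b) * b ^ (k ∸ t))
                           (trans (cong (λ n → y /^ n) (block-position d k j t 1≤j j≤d t≤k))
                                  (/^-+ y ((d ∸ j) * k) (k ∸ t)))))
          (low-digits k (y /^ ((d ∸ j) * k)))

  -- Since b^k = 1 + m, cutting the d·k lowest digits of y into d blocks of k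
  -- digits preserves y modulo m: the remainder is the block sum plus m·X.
  blocks-congruence : ∀ k m → b ^ k ≡ suc m → ∀ d y →
    ∃ λ X → y %^ (d * k) ≡ sum1 d (λ j → (y /^ ((d ∸ j) * k)) %^ k) + m * X
  blocks-congruence k m b^k≡1+m zero    y = 0 , trans (n%1≡0 y) (sym (*-zeroʳ m))
  blocks-congruence k m b^k≡1+m (suc d) y with blocks-congruence k m b^k≡1+m d (y /^ k)
  ... | X , high≡ = X + Σhigh + m * X , (begin
    y %^ (k + d * k)
      ≡⟨ %-congʳ {{m^n≢0 b (k + d * k)}} {{nz}} (^-distribˡ-+-* b k (d * k)) ⟩
    _%_ y (b ^ k * b ^ (d * k)) {{nz}}
      ≡⟨ %-*-split y (b ^ k) (b ^ (d * k)) {{m^n≢0 b k}} {{m^n≢0 b (d * k)}} {{nz}} ⟩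
    b ^ k * ((y /^ k) %^ (d * k)) + y %^ k
      ≡⟨ cong₂ (λ u v → u * v + y %^ k) b^k≡1+m high≡ ⟩
    suc m * (Σhigh + m * X) + y %^ k
      ≡⟨ regroup m Σhigh X (y %^ k) ⟩
    (Σhigh + y %^ k) + m * (X + Σhigh + m * X)
      ≡⟨ cong (λ u → u + m * (X + Σhigh + m * X)) (sym (cong₂ _+_ upper-blocks lowest-block)) ⟩
    (sum1 d A + A (suc d)) + m * (X + Σhigh + m * X) ∎)
    where
    open ≡-Reasoning
    nz : NonZero (b ^ k * b ^ (d * k))
    nz = subst NonZero (^-distribˡ-+-* b k (d * k)) (m^n≢0 b (k + d * k))
    A : ℕ → ℕ
    A j = (y /^ ((suc d ∸ j) * k)) %^ k
    Σhigh : ℕ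
    Σhigh = sum1 d (λ j → ((y /^ k) /^ ((d ∸ j) * k)) %^ k)
    regroup : ∀ m S X r → suc m * (S + m * X) + r ≡ (S + r) + m * (X + S + m * X)
    regroup = solve-∀
    upper-blocks : sum1 d A ≡ Σhigh
    upper-blocks = sum1-cong d λ j _ j≤d →
      cong (_%^ k) (trans (cong (λ u → y /^ (u * k)) (+-∸-assoc 1 j≤d)) (/^-+ y k ((d ∸ j) * k)))
    lowest-block : A (suc d) ≡ y %^ k
    lowest-block = cong (_%^ k) (trans (cong (λ u → y /^ (u * k)) (n∸n≡0 d)) (n/1≡n y))

period≡S-mod : ∀ b .{{_ : NonZero b}} N .{{_ : NonZero N}} L d k x → L ≡ d * k → period b N L x < b ^ L →
               ∃ λ X → period b N L x ≡ S b N L d k x + (b ^ k ∸ 1) * X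
period≡S-mod b N .(d * k) d k x refl y<b^L = X , (begin
  y                                                   ≡⟨ sym (m<n⇒m%n≡m {{m^n≢0 b (d * k)}} y<b^L) ⟩
  y %^ (d * k)                                        ≡⟨ proj₂ congruence ⟩
  sum1 d (λ j → (y /^ ((d ∸ j) * k)) %^ k) + (b ^ k ∸ 1) * X
    ≡⟨ cong (_+ (b ^ k ∸ 1) * X) (sym (sum1-cong d λ j 1≤j j≤d → block≡ d k j y 1≤j j≤d)) ⟩
  S b N (d * k) d k x + (b ^ k ∸ 1) * X               ∎)
  where
  open ≡-Reasoning
  open Positional b
  y : ℕ
  y = period b N (d * k) x
  congruence : ∃ λ X → y %^ (d * k) ≡ sum1 d (λ j → (y /^ ((d ∸ j) * k)) %^ k) + (b ^ k ∸ 1) * X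
  congruence = blocks-congruence k (b ^ k ∸ 1) (sym (suc-pred (b ^ k) {{m^n≢0 b k}})) d y
  X : ℕ
  X = proj₁ congruence

m∣[1+m]^e∸1 : ∀ m e → m ∣ suc m ^ e ∸ 1
m∣[1+m]^e∸1 m zero = m ∣0
m∣[1+m]^e∸1 m (suc e) with suc m ^ e | m^n>0 (suc m) e | m∣[1+m]^e∸1 m e
... | suc t | _ | m∣t = ∣m∣n⇒∣m+n m∣t (m∣m*n (suc t))

b^k∸1∣b^ek∸1 : ∀ b .{{_ : NonZero b}} e k → b ^ k ∸ 1 ∣ b ^ (e * k) ∸ 1
b^k∸1∣b^ek∸1 b e k = subst (λ u → b ^ k ∸ 1 ∣ u ∸ 1) (begin
  suc (b ^ k ∸ 1) ^ e ≡⟨ cong (_^ e) (suc-pred (b ^ k) {{m^n≢0 b k}}) ⟩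
  (b ^ k) ^ e         ≡⟨ ^-*-assoc b k e ⟩
  b ^ (k * e)         ≡⟨ cong (b ^_) (*-comm k e) ⟩
  b ^ (e * k)         ∎) (m∣[1+m]^e∸1 (b ^ k ∸ 1) e)
  where open ≡-Reasoning

conjugate-factor : ∀ B z N → 2 ≤ B → B ∸ 1 ∣ z → B * B ∸ 1 ≡ z * N → N ∣ suc B
conjugate-factor (suc (suc m′)) z N (s≤s (s≤s z≤n)) (divides w z≡wm) B²∸1≡zN =
  divides w (sym (*-cancelˡ-≡ (w * N) (suc (suc m)) m (begin
    m * (w * N)      ≡⟨ reassoc w m N ⟩
    w * m * N        ≡⟨ cong (_* N) (sym z≡wm) ⟩
    z * N            ≡⟨ sym B²∸1≡zN ⟩
    m + m * suc m    ≡⟨ factor m ⟩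
    m * suc (suc m)  ∎)))
  where
  open ≡-Reasoning
  m : ℕ
  m = suc m′
  reassoc : ∀ w m N → m * (w * N) ≡ w * m * N
  reassoc = solve-∀
  factor : ∀ m → m + m * suc m ≡ m * suc (suc m)
  factor = solve-∀

N∤b^n : ∀ N b n → Coprime N b → N ≢ 1 → ¬ N ∣ b ^ n
N∤b^n N b zero    cop N≢1 N∣1 = N≢1 (∣1⇒≡1 N∣1)
N∤b^n N b (suc n) cop N≢1 N∣b^n = N∤b^n N b n cop N≢1 (coprime-divisor cop N∣b^n)

-- If N ∣ B + 1 then B·p ≡ −p (mod N); when N ∤ p the two least residues are
-- nonzero and sum to a multiple of N below 2N, hence to exactly N.
residues-pair : ∀ N .{{_ : NonZero N}} B p → N ∣ suc B → ¬ N ∣ p → p % N + (B * p) % N ≡ N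
residues-pair N B p N∣1+B N∤p = exactly-N N∣r
  where
  r : ℕ
  r = p % N + (B * p) % N
  regroup : ∀ r q r′ q′ N → r + q * N + (r′ + q′ * N) ≡ (q + q′) * N + (r + r′)
  regroup = solve-∀
  p+Bp≡ : p + B * p ≡ (p / N + (B * p) / N) * N + r
  p+Bp≡ = trans (cong₂ _+_ (m≡m%n+[m/n]*n p N) (m≡m%n+[m/n]*n (B * p) N))
                (regroup (p % N) (p / N) ((B * p) % N) ((B * p) / N) N)
  -- p + B·p = (1 + B)·p is a multiple of N, hence so is r
  N∣r : N ∣ r
  N∣r = ∣m+n∣m⇒∣n (subst (N ∣_) p+Bp≡ (∣-trans N∣1+B (m∣m*n p))) (n∣m*n (p / N + (B * p) / N))
  r<2N : r < N + N
  r<2N = +-mono-< (m%n<n p N) (m%n<n (B * p) N)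
  exactly-N : N ∣ r → r ≡ N
  exactly-N (divides zero          r≡0) = ⊥-elim (N∤p (m%n≡0⇒n∣m p N (m+n≡0⇒m≡0 (p % N) r≡0)))
  exactly-N (divides (suc zero)    r≡N) = trans r≡N (+-identityʳ N)
  exactly-N (divides (suc (suc q)) r≡)  =
    ⊥-elim (<⇒≱ r<2N (subst (N + N ≤_) (sym r≡) (+-monoʳ-≤ N (m≤m+n N (q * N)))))

midySum-even : ∀ b N .{{_ : NonZero N}} e k → Coprime N b → N ≢ 1 → N ∣ suc (b ^ (e * k)) →
               midySum b N (e * 2) k ≡ e * N
midySum-even b N e k cop N≢1 N∣1+b^ek =
  trans (cong (λ n → sum1 n f) (double e)) (sum1-pairs e f N pair)
  where
  f : ℕ → ℕ
  f i = b ^ (i * k) % N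
  double : ∀ e → e * 2 ≡ e + e
  double = solve-∀
  b^[e+i]k≡ : ∀ i → b ^ ((e + i) * k) ≡ b ^ (e * k) * b ^ (i * k)
  b^[e+i]k≡ i = trans (cong (b ^_) (*-distribʳ-+ k e i)) (^-distribˡ-+-* b (e * k) (i * k))
  pair : ∀ i → 1 ≤ i → i ≤ e → f i + f (e + i) ≡ N
  pair i _ _ = trans (cong (f i +_) (%-congˡ (b^[e+i]k≡ i)))
                     (residues-pair N (b ^ (e * k)) (b ^ (i * k)) N∣1+b^ek (N∤b^n N b (i * k) cop N≢1))

divisor-positive : ∀ {d n} → d ∣ n → 1 ≤ n → 1 ≤ d
divisor-positive {zero}  0∣n 1≤n = ⊥-elim (<⇒≱ 1≤n (≤-reflexive (0∣⇒≡0 0∣n)))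
divisor-positive {suc d} _   _   = s≤s z≤n

module Period (b N L z : ℕ) .{{_ : NonZero b}} .{{_ : NonZero N}} (b^L∸1≡zN : b ^ L ∸ 1 ≡ z * N) where

  period≡ : ∀ x → period b N L x ≡ x * z
  period≡ x = begin
    x * (b ^ L ∸ 1) / N  ≡⟨ /-congˡ (cong (x *_) b^L∸1≡zN) ⟩
    x * (z * N) / N      ≡⟨ /-congˡ (sym (*-assoc x z N)) ⟩
    x * z * N / N        ≡⟨ m*n/n≡m (x * z) N ⟩
    x * z                ∎
    where open ≡-Reasoning

  period< : ∀ x → x ≤ N → period b N L x < b ^ L
  period< x x≤N = begin-strict
    period b N L x  ≡⟨ period≡ x ⟩
    x * z           ≤⟨ *-monoˡ-≤ z x≤N ⟩
    N * z           ≡⟨ trans (*-comm N z) (sym b^L∸1≡zN) ⟩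
    b ^ L ∸ 1       <⟨ m≤pred[n]⇒suc[m]≤n {{m^n≢0 b L}} ≤-refl ⟩
    b ^ L           ∎
    where open ≤-Reasoning

  midy⇒period : ∀ d k x → L ≡ d * k → x ≤ N → b ^ k ∸ 1 ∣ S b N L d k x → b ^ k ∸ 1 ∣ x * z
  midy⇒period d k x L≡dk x≤N m∣S with period≡S-mod b N L d k x L≡dk (period< x x≤N)
  ... | X , period≡S+mX = subst (b ^ k ∸ 1 ∣_) (trans (sym period≡S+mX) (period≡ x))
                                (∣m∣n⇒∣m+n m∣S (m∣m*n X))

  period⇒midy : ∀ d k x → L ≡ d * k → x ≤ N → b ^ k ∸ 1 ∣ x * z → b ^ k ∸ 1 ∣ S b N L d k x
  period⇒midy d k x L≡dk x≤N m∣xz with period≡S-mod b N L d k x L≡dk (period< x x≤N)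
  ... | X , period≡S+mX = ∣m+n∣m⇒∣n (subst (b ^ k ∸ 1 ∣_) xz≡ m∣xz) (m∣m*n X)
    where
    xz≡ : x * z ≡ (b ^ k ∸ 1) * X + S b N L d k x
    xz≡ = trans (sym (period≡ x)) (trans period≡S+mX (+-comm (S b N L d k x) ((b ^ k ∸ 1) * X)))

  midy⇒b^k∸1∣z : ∀ d k → L ≡ d * k → N ≢ 1 → MidyProp b N L d → b ^ k ∸ 1 ∣ z
  midy⇒b^k∸1∣z d k L≡dk N≢1 midy = subst (b ^ k ∸ 1 ∣_) (*-identityˡ z)
    (midy⇒period d k 1 L≡dk 1≤N (midy k L≡dk 1 (≤-refl , ≤∧≢⇒< 1≤N (≢-sym N≢1) , 1-coprimeTo N)))
    where
    1≤N : 1 ≤ N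
    1≤N = >-nonZero⁻¹ N

  b^k∸1∣z⇒midy : ∀ d → (∀ k → L ≡ d * k → b ^ k ∸ 1 ∣ z) → MidyProp b N L d
  b^k∸1∣z⇒midy d b^k∸1∣z k L≡dk x (_ , x<N , _) =
    period⇒midy d k x L≡dk (<⇒≤ x<N) (∣-trans (b^k∸1∣z k L≡dk) (n∣m*n x))

  -- For L = 2k: z·N = (b^k − 1)(b^k + 1), so b^k − 1 ∣ z yields N ∣ b^k + 1.
  N∣b^k+1 : ∀ k → L ≡ k * 2 → 2 ≤ b → 1 ≤ L → b ^ k ∸ 1 ∣ z → N ∣ suc (b ^ k)
  N∣b^k+1 k L≡2k 2≤b 1≤L b^k∸1∣z =
    conjugate-factor (b ^ k) z N 2≤b^k b^k∸1∣z (trans (cong (_∸ 1) (sym b^L≡b^k²)) b^L∸1≡zN)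
    where
    1≤k : 1 ≤ k
    1≤k = divisor-positive (divides 2 (trans L≡2k (*-comm k 2))) 1≤L
    2≤b^k : 2 ≤ b ^ k
    2≤b^k = ≤-trans 2≤b (subst (_≤ b ^ k) (*-identityʳ b) (^-monoʳ-≤ b 1≤k))
    b^L≡b^k² : b ^ L ≡ b ^ k * b ^ k
    b^L≡b^k² = trans (cong (b ^_) L≡2k) (trans (sym (^-*-assoc b k 2)) (cong (b ^ k *_) (*-identityʳ _)))

-- N = 1 is excluded once the order L is at least 2, since b^1 ≡ 1 (mod 1).
modulus≢1 : ∀ {b N L} → IsOrder b N L → 2 ≤ L → N ≢ 1
modulus≢1 {b} (_ , _ , minimal) 2≤L N≡1 = minimal 1 ≤-refl 2≤L (subst (_∣ b ^ 1 ∸ 1) (sym N≡1) (1∣ _))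

half-exponent : ∀ {L} k₀ e k → L ≡ k₀ * 2 → L ≡ e * 2 * k → k₀ ≡ e * k
half-exponent k₀ e k L≡2k₀ L≡2ek =
  *-cancelʳ-≡ k₀ (e * k) 2 (trans (trans (sym L≡2k₀) L≡2ek) (swap e k))
  where
  swap : ∀ e k → e * 2 * k ≡ e * k * 2
  swap = solve-∀

even-positive⇒≥2 : ∀ e n → n ≡ e * 2 → 1 ≤ n → 2 ≤ n
even-positive⇒≥2 zero    .0 refl ()
even-positive⇒≥2 (suc e) n  n≡  _ = subst (2 ≤_) (sym n≡) (s≤s (s≤s z≤n))

theorem2p4 : (b N L : ℕ) → .{{_ : NonZero b}} → .{{_ : NonZero N}} →
    2 ≤ b → Coprime N b → IsOrder b N L →
    InMidySet b N L 2 →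
    (d : ℕ) → 2 ∣ d → d ∣ L →
    InMidySet b N L d × (∀ k → L ≡ d * k → midySum b N d k ≡ (d / 2) * N)
theorem2p4 b N L 2≤b cop order@(1≤L , divides z b^L∸1≡zN , _) (_ , divides k₀ L≡2k₀ , midy₂)
           .(e * 2) (divides e refl) d∣L =
  (even-positive⇒≥2 e (e * 2) refl (divisor-positive d∣L 1≤L) , d∣L , midy-d) , midySum-d
  where
  open Period b N L z b^L∸1≡zN
  N≢1 : N ≢ 1
  N≢1 = modulus≢1 order (even-positive⇒≥2 k₀ L L≡2k₀ 1≤L)
  b^k₀∸1∣z : b ^ k₀ ∸ 1 ∣ z
  b^k₀∸1∣z = midy⇒b^k∸1∣z 2 k₀ (trans L≡2k₀ (*-comm k₀ 2)) N≢1 midy₂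
  -- b^k − 1 ∣ b^{k₀} − 1 ∣ z, as k₀ = e·k
  midy-d : MidyProp b N L (e * 2)
  midy-d = b^k∸1∣z⇒midy (e * 2) λ k L≡dk →
    ∣-trans (subst (λ u → b ^ k ∸ 1 ∣ b ^ u ∸ 1) (sym (half-exponent k₀ e k L≡2k₀ L≡dk))
                   (b^k∸1∣b^ek∸1 b e k))
            b^k₀∸1∣z
  -- N ∣ b^{k₀} + 1 = b^{ek} + 1 makes the Midy sum pair up
  midySum-d : ∀ k → L ≡ e * 2 * k → midySum b N (e * 2) k ≡ (e * 2 / 2) * N
  midySum-d k L≡dk = trans
    (midySum-even b N e k cop N≢1
      (subst (λ u → N ∣ suc (b ^ u)) (half-exponent k₀ e k L≡2k₀ L≡dk)
             (N∣b^k+1 k₀ L≡2k₀ 2≤b 1≤L b^k₀∸1∣z)))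
    (cong (_* N) (sym (m*n/n≡m e 2)))
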